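{- For $n\ge 1$ and $0\le k\le n-1$, the number of descending plane partitions of order $n$ with exactly $k$ rows and no special part equals the Eulerian number $E(n,k)$.
   Context: A descending plane partition (DPP) is an array $a=(a_{ij})$ of positive integers, defined for $j\ge i\ge 1$, arranged in $r$ rows (shifted so that row $i$ starts in column $i$), where row $i$ consists of $a_{i,i},\dots,a_{i,\mu_i}$, such that: (1) $\mu_1\ge\dots\ge\mu_r$; (2) $a_{i,j}\ge a_{i,j+1}$ and $a_{i,j}>a_{i+1,j}$ whenever both sides are defined; (3) $a_{i,i}>\mu_i-i+1$ for $1\le i\le r$; (4) $a_{i,i}\le \mu_{i-1}-i+2$ for $1<i\le r$. The number of rows is $r$; the empty DPP has $0$ rows. A DPP has order $n$ if all entries are $\le n$. An entry $a_{i,j}$ is a special part if $a_{i,j}\le j-i$. The Eulerian numbers are defined by $E(0,k)=\delta_{k,0}$ and $E(n,k)=(k+1)E(n-1,k)+(n-k)E(n-1,k-1)$ for $n\ge1$, $0\le k\le n$ (with $E(n-1,-1)=0$). -}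

module Defs where

open import Data.Nat using (ℕ; zero; suc; _+_; _*_; _∸_; _≤ᵇ_; _<ᵇ_; _≡ᵇ_)
open import Data.Bool using (Bool; true; false; _∧_; _∨_; not; T)
open import Data.List using (List; []; _∷_; length; map; upTo)
open import Data.Product using (Σ; _×_)

eulerian : ℕ → ℕ → ℕ
eulerian zero    zero    = 1
eulerian zero    (suc k) = 0
eulerian (suc n) zero    = 1 * eulerian n zero
eulerian (suc n) (suc k) = (suc k + 1) * eulerian n (suc k) + (suc n ∸ suc k) * eulerian n k

-- A candidate array is a list of rows; the i-th list (1-indexed) is row i,
-- i.e. the entries a_{i,i}, a_{i,i+1}, ..., a_{i,μ_i} in this order.
Array : Set
Array = List (List ℕ)

nrows : Array → ℕ
nrows = length

nth : {A : Set} → A → List A → ℕ → A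
nth d []       _       = d
nth d (x ∷ xs) zero    = x
nth d (x ∷ xs) (suc m) = nth d xs m

row : Array → ℕ → List ℕ
row a i = nth [] a (i ∸ 1)

-- μ_i : index of the last column of row i (row i starts in column i)
μ : Array → ℕ → ℕ
μ a i = (i ∸ 1) + length (row a i)

-- the entry a_{i,j} (meaningful for 1 ≤ i ≤ r, i ≤ j ≤ μ_i)
ent : Array → ℕ → ℕ → ℕ
ent a i j = nth 0 (row a i) (j ∸ i)

range : ℕ → ℕ → List ℕ
range lo hi = map (lo +_) (upTo (suc hi ∸ lo))

allL : (ℕ → Bool) → List ℕ → Bool
allL p []       = true
allL p (x ∷ xs) = p x ∧ allL p xs

allIn : ℕ → ℕ → (ℕ → Bool) → Bool
allIn lo hi p = allL p (range lo hi)

_⇒ᵇ_ : Bool → Bool → Bool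
b ⇒ᵇ c = not b ∨ c

wellShaped : Array → Bool
wellShaped a = allIn 1 (nrows a) λ i →
  (1 ≤ᵇ length (row a i)) ∧ allIn i (μ a i) λ j → 1 ≤ᵇ ent a i j

cond1 : Array → Bool
cond1 a = allIn 1 (nrows a ∸ 1) λ i → μ a (suc i) ≤ᵇ μ a i

cond2 : Array → Bool
cond2 a =
  (allIn 1 (nrows a) λ i → allIn i (μ a i ∸ 1) λ j →
     ent a i (suc j) ≤ᵇ ent a i j)
  ∧ (allIn 1 (nrows a ∸ 1) λ i → allIn (suc i) (μ a (suc i)) λ j →
     (j ≤ᵇ μ a i) ⇒ᵇ (ent a (suc i) j <ᵇ ent a i j))

cond3 : Array → Bool
cond3 a = allIn 1 (nrows a) λ i → (suc (μ a i) ∸ i) <ᵇ ent a i i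

cond4 : Array → Bool
cond4 a = allIn 2 (nrows a) λ i → ent a i i ≤ᵇ ((μ a (i ∸ 1) + 2) ∸ i)

isDPP : Array → Bool
isDPP a = wellShaped a ∧ cond1 a ∧ cond2 a ∧ cond3 a ∧ cond4 a

hasOrder : ℕ → Array → Bool
hasOrder n a = allIn 1 (nrows a) λ i → allIn i (μ a i) λ j → ent a i j ≤ᵇ n

noSpecialPart : Array → Bool
noSpecialPart a = allIn 1 (nrows a) λ i → allIn i (μ a i) λ j →
  not (ent a i j ≤ᵇ (j ∸ i))

-- DPPs of order n with exactly k rows and no special part
-- (predicates are Bool-valued, so membership proofs are unique)
DPPNoSpecial : ℕ → ℕ → Set
DPPNoSpecial n k = Σ Array λ a →
  T (isDPP a) × T (hasOrder n a) × T (nrows a ≡ᵇ k) × T (noSpecialPart a)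

-- Without special parts, a DPP of order n is a list of weakly decreasing rows in which every
-- entry is at least the length of its row and the first entry exceeds it; the entries of a row
-- are at most the length of the row above, and lie strictly below that row shifted one column
-- to the right. Read the entries from n downwards: at threshold v a partially read DPP is
-- determined by its unread part and by the number s of entries of the current row exceeding v.
-- Lowering the threshold to v - 1 either lets the current row take further entries equal to v
-- or closes it, and the next row then starts with fewer than s entries equal to v. This gives
-- a recursion for the number partialCount v s k of such states, which by induction on v obeys
-- the Eulerian recurrence E(v+1,k+1) = (k+2) E(v,k+1) + (v-k) E(v,k) for every s ≤ v.

module Submission where

open import Defs
open import Data.Nat
open import Data.Nat.Properties
open import Data.Nat.Tactic.RingSolver using (solve-∀)
open import Data.Bool using (Bool; true; false; T; _∧_; not; if_then_else_)
open import Data.Bool.Properties using (T-∧; T-≡; T-not-≡; ¬-not; T-irrelevant)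
open import Data.Empty using (⊥-elim)
open import Data.Unit using (⊤; tt)
open import Data.Sum using (_⊎_; inj₁; inj₂)
open import Data.Sum.Function.Propositional using (_⊎-↔_)
open import Data.Product using (Σ; _×_; _,_; proj₁; proj₂)
open import Data.List using (List; []; _∷_; length; _++_; replicate; drop; map; applyUpTo)
open import Data.List.Properties using (length-++; length-replicate)
open import Data.List.Relation.Unary.All as All using (All; []; _∷_)
open import Data.List.Relation.Unary.All.Properties using (++⁺; ++⁻ʳ; drop⁺; replicate⁺)
open import Data.List.Relation.Unary.Linked as Linked using (Linked; []; [-]; _∷_)
open import Data.List.Relation.Unary.Linked.Properties using (Linked⇒All)
open import Data.Fin using (Fin)
open import Data.Fin.Properties using (+↔⊎)
open import Function using (_∘_; id; _⟨_⟩_)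
open import Function.Bundles using (_↔_; mk↔ₛ′; Equivalence; _⇔_; mk⇔)
open import Function.Properties.Inverse using (↔-trans; ↔-sym)
open import Function.Related.Propositional using (module EquationalReasoning)
open import Relation.Binary.PropositionalEquality
open import Relation.Nullary using (¬_; yes; no)
open import Relation.Nullary.Irrelevant using (Irrelevant)

-- Finite sums and the counting recursion

<∸⇒+≤ : ∀ {s t v} → s ≤ suc v → t < suc v ∸ s → s + t ≤ v
<∸⇒+≤ {s} {t} s≤1+v t< = ≤-pred (subst (s + t <_) (m+[n∸m]≡n s≤1+v) (+-monoʳ-< s t<))

+≤⇒<∸ : ∀ {s t v} → s + t ≤ v → t < suc v ∸ s
+≤⇒<∸ {s} {t} {v} s+t≤v = subst (t <_) (sym (+-∸-assoc 1 (≤-trans (m≤m+n s t) s+t≤v)))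
  (s≤s (m+n≤o⇒m≤o∸n t (subst (_≤ v) (+-comm s t) s+t≤v)))

sumBelow : ℕ → (ℕ → ℕ) → ℕ
sumBelow zero    f = 0
sumBelow (suc m) f = f 0 + sumBelow m (f ∘ suc)

sumBelow-cong : ∀ m {f g} → (∀ i → i < m → f i ≡ g i) → sumBelow m f ≡ sumBelow m g
sumBelow-cong zero    _   = refl
sumBelow-cong (suc m) f≗g = cong₂ _+_ (f≗g 0 z<s) (sumBelow-cong m (λ i i<m → f≗g (suc i) (s<s i<m)))

sumBelow-zero : ∀ m {f} → (∀ i → i < m → f i ≡ 0) → sumBelow m f ≡ 0
sumBelow-zero zero    _   = refl
sumBelow-zero (suc m) f≗0 = cong₂ _+_ (f≗0 0 z<s) (sumBelow-zero m (λ i i<m → f≗0 (suc i) (s<s i<m)))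

sumBelow-linear : ∀ m a b f g →
  sumBelow m (λ i → a * f i + b * g i) ≡ a * sumBelow m f + b * sumBelow m g
sumBelow-linear zero    a b f g = sym (cong₂ _+_ (*-zeroʳ a) (*-zeroʳ b))
sumBelow-linear (suc m) a b f g = begin
  (a * f 0 + b * g 0) + sumBelow m (λ i → a * f (suc i) + b * g (suc i))
    ≡⟨ cong (a * f 0 + b * g 0 +_) (sumBelow-linear m a b (f ∘ suc) (g ∘ suc)) ⟩
  (a * f 0 + b * g 0) + (a * sumBelow m (f ∘ suc) + b * sumBelow m (g ∘ suc))
    ≡⟨ regroup a b (f 0) (g 0) _ _ ⟩
  a * (f 0 + sumBelow m (f ∘ suc)) + b * (g 0 + sumBelow m (g ∘ suc)) ∎
  where
  open ≡-Reasoning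
  regroup : ∀ a b x y X Y → a * x + b * y + (a * X + b * Y) ≡ a * (x + X) + b * (y + Y)
  regroup = solve-∀

sumBelow-+ : ∀ m n f → sumBelow (m + n) f ≡ sumBelow m f + sumBelow n (λ t → f (m + t))
sumBelow-+ zero    n f = refl
sumBelow-+ (suc m) n f = cong (f 0 +_) (sumBelow-+ m n (f ∘ suc)) ⟨ trans ⟩ sym (+-assoc (f 0) _ _)

sumBelow-split : ∀ {m n} f → m ≤ n → sumBelow n f ≡ sumBelow m f + sumBelow (n ∸ m) (λ t → f (m + t))
sumBelow-split {m} {n} f m≤n = cong (λ x → sumBelow x f) (sym (m+[n∸m]≡n m≤n)) ⟨ trans ⟩ sumBelow-+ m (n ∸ m) f

sumBelow-last : ∀ m f → sumBelow (suc m) f ≡ sumBelow m f + f m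
sumBelow-last m f = begin
  sumBelow (suc m) f              ≡⟨ cong (λ x → sumBelow x f) (+-comm 1 m) ⟩
  sumBelow (m + 1) f              ≡⟨ sumBelow-+ m 1 f ⟩
  sumBelow m f + (f (m + 0) + 0)  ≡⟨ cong (sumBelow m f +_) (+-identityʳ _ ⟨ trans ⟩ cong f (+-identityʳ m)) ⟩
  sumBelow m f + f m              ∎
  where open ≡-Reasoning

δ : ℕ → ℕ
δ zero    = 1
δ (suc _) = 0

sumBelow-δ : ∀ s m → sumBelow (suc m ∸ s) (λ t → δ (s + t)) ≡ δ s
sumBelow-δ zero    m = cong suc (sumBelow-zero m (λ _ _ → refl))
sumBelow-δ (suc s) m = sumBelow-zero (m ∸ s) (λ _ _ → refl)

-- For s ≤ v, partialCount v s k counts the states Partial v s k defined below. Passing from threshold v + 1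
-- to v, the current row takes t further entries equal to v + 1 (first sum), or it is complete and
-- the next row becomes current with c < s entries equal to v + 1 (second sum).
partialCount : ℕ → ℕ → ℕ → ℕ
partialCount v       s zero    = δ s
partialCount zero    s (suc k) = 0
partialCount (suc v) s (suc k) =
  sumBelow (suc v ∸ s) (λ t → partialCount v (s + t) (suc k)) + sumBelow s (λ c → partialCount v c k)

partialCount-vanishes : ∀ v s k → v ≤ k → partialCount v s (suc k) ≡ 0
partialCount-vanishes zero    s k       _         = refl
partialCount-vanishes (suc v) s (suc k) (s≤s v≤k) = cong₂ _+_
  (sumBelow-zero (suc v ∸ s) (λ t _ → partialCount-vanishes v (s + t) (suc k) (m≤n⇒m≤1+n v≤k)))
  (sumBelow-zero s (λ c _ → partialCount-vanishes v c k v≤k))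

[v∸1+k]*X+X≡[v∸k]*X : ∀ v k X → (v ≤ k → X ≡ 0) → (v ∸ suc k) * X + X ≡ (v ∸ k) * X
[v∸1+k]*X+X≡[v∸k]*X v k X vanish with k <? v
... | yes k<v = +-comm _ X ⟨ trans ⟩ cong (_* X) (sym (+-∸-assoc 1 k<v))
... | no  k≮v rewrite vanish (≮⇒≥ k≮v) = +-identityʳ _ ⟨ trans ⟩ *-zeroʳ (v ∸ suc k) ⟨ trans ⟩ sym (*-zeroʳ (v ∸ k))

partialCount-recurrence : ∀ v s k → s ≤ v →
  partialCount (suc v) s (suc k) ≡ (suc k + 1) * partialCount v s (suc k) + (v ∸ k) * partialCount v s k
partialCount-recurrence zero    zero k z≤n =
  sym (cong₂ _+_ (*-zeroʳ (suc k + 1)) (cong (_* partialCount 0 0 k) (0∸n≡0 k)))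
partialCount-recurrence (suc v) s    k s≤1+v = combine k
  where
  open ≡-Reasoning
  P = partialCount
  A B : ℕ → ℕ
  A k = sumBelow (suc v ∸ s) (λ t → P v (s + t) k)
  B k = sumBelow s (λ c → P v c k)

  full-row : ∀ k → P (suc v) (s + (suc v ∸ s)) (suc k) ≡ B k + A k
  full-row k = begin
    P (suc v) (s + (suc v ∸ s)) (suc k)   ≡⟨ cong (λ x → P (suc v) x (suc k)) (m+[n∸m]≡n s≤1+v) ⟩
    sumBelow (v ∸ v) (λ t → P v (suc v + t) (suc k)) + sumBelow (suc v) (λ c → P v c k)
      ≡⟨ cong (λ x → sumBelow x (λ t → P v (suc v + t) (suc k)) + sumBelow (suc v) (λ c → P v c k)) (n∸n≡0 v) ⟩
    sumBelow (suc v) (λ c → P v c k)      ≡⟨ sumBelow-split (λ c → P v c k) s≤1+v ⟩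
    B k + A k                             ∎

  continuing : ∀ k → sumBelow (suc (suc v) ∸ s) (λ t → P (suc v) (s + t) (suc k))
                     ≡ ((suc k + 1) * A (suc k) + (v ∸ k) * A k) + (B k + A k)
  continuing k = begin
    sumBelow (suc (suc v) ∸ s) f            ≡⟨ cong (λ x → sumBelow x f) (+-∸-assoc 1 s≤1+v) ⟩
    sumBelow (suc (suc v ∸ s)) f            ≡⟨ sumBelow-last (suc v ∸ s) f ⟩
    sumBelow (suc v ∸ s) f + f (suc v ∸ s)  ≡⟨ cong₂ _+_ shorter (full-row k) ⟩
    ((suc k + 1) * A (suc k) + (v ∸ k) * A k) + (B k + A k) ∎
    where
    f = λ t → P (suc v) (s + t) (suc k)
    shorter : sumBelow (suc v ∸ s) f ≡ (suc k + 1) * A (suc k) + (v ∸ k) * A k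
    shorter = sumBelow-cong (suc v ∸ s) (λ t t< → partialCount-recurrence v (s + t) k (<∸⇒+≤ s≤1+v t<))
      ⟨ trans ⟩ sumBelow-linear (suc v ∸ s) (suc k + 1) (v ∸ k) (λ t → P v (s + t) (suc k)) (λ t → P v (s + t) k)

  combine : ∀ k → P (suc (suc v)) s (suc k) ≡ (suc k + 1) * P (suc v) s (suc k) + (suc v ∸ k) * P (suc v) s k
  combine zero = begin
    sumBelow (suc (suc v) ∸ s) (λ t → P (suc v) (s + t) 1) + B 0
      ≡⟨ cong (_+ B 0) (continuing 0) ⟩
    (2 * A 1 + v * A 0) + (B 0 + A 0) + B 0
      ≡⟨ cong (λ x → (2 * A 1 + v * x) + (B 0 + x) + B 0) (sumBelow-δ s v) ⟩
    (2 * A 1 + v * δ s) + (B 0 + δ s) + B 0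
      ≡⟨ regroup (A 1) (B 0) (δ s) v ⟩
    2 * (A 1 + B 0) + suc v * δ s ∎
    where
    regroup : ∀ a b x v → (2 * a + v * x) + (b + x) + b ≡ 2 * (a + b) + suc v * x
    regroup = solve-∀
  combine (suc k) = begin
    sumBelow (suc (suc v) ∸ s) (λ t → P (suc v) (s + t) (suc (suc k))) + sumBelow s (λ c → P (suc v) c (suc k))
      ≡⟨ cong₂ _+_ (continuing (suc k)) closing ⟩
    ((K * A (2 + k) + (v ∸ suc k) * A (suc k)) + (B (suc k) + A (suc k))) + ((suc k + 1) * B (suc k) + (v ∸ k) * B k)
      ≡⟨ regroup (suc k + 1) (A (2 + k)) (A (suc k)) (B (suc k)) (B k) (v ∸ suc k) (v ∸ k) ⟩
    K * (A (2 + k) + B (suc k)) + ((v ∸ suc k) * A (suc k) + A (suc k)) + (v ∸ k) * B k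
      ≡⟨ cong (λ x → K * (A (2 + k) + B (suc k)) + x + (v ∸ k) * B k) ([v∸1+k]*X+X≡[v∸k]*X v k (A (suc k)) vanish) ⟩
    K * (A (2 + k) + B (suc k)) + (v ∸ k) * A (suc k) + (v ∸ k) * B k
      ≡⟨ +-assoc (K * (A (2 + k) + B (suc k))) _ _ ⟨ trans ⟩
         cong (K * (A (2 + k) + B (suc k)) +_) (sym (*-distribˡ-+ (v ∸ k) (A (suc k)) (B k))) ⟩
    K * (A (2 + k) + B (suc k)) + (v ∸ k) * (A (suc k) + B k) ∎
    where
    K = suc (suc k) + 1
    closing : sumBelow s (λ c → P (suc v) c (suc k)) ≡ (suc k + 1) * B (suc k) + (v ∸ k) * B k
    closing = sumBelow-cong s (λ c c<s → partialCount-recurrence v c k (≤-pred (≤-trans c<s s≤1+v)))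
      ⟨ trans ⟩ sumBelow-linear s (suc k + 1) (v ∸ k) (λ c → P v c (suc k)) (λ c → P v c k)
    vanish : v ≤ k → A (suc k) ≡ 0
    vanish v≤k = sumBelow-zero (suc v ∸ s) (λ t _ → partialCount-vanishes v (s + t) k v≤k)
    regroup : ∀ K a₂ a₁ b₁ b₀ c₁ c₀ → ((suc K * a₂ + c₁ * a₁) + (b₁ + a₁)) + (K * b₁ + c₀ * b₀)
                                     ≡ suc K * (a₂ + b₁) + (c₁ * a₁ + a₁) + c₀ * b₀
    regroup = solve-∀

partialCount-eulerian : ∀ n k → partialCount n 0 k ≡ eulerian n k
partialCount-eulerian zero    zero    = refl
partialCount-eulerian zero    (suc k) = refl
partialCount-eulerian (suc n) zero    = partialCount-eulerian n 0 ⟨ trans ⟩ sym (+-identityʳ _)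
partialCount-eulerian (suc n) (suc k) = partialCount-recurrence n 0 k z≤n ⟨ trans ⟩
  cong₂ (λ x y → (suc k + 1) * x + (n ∸ k) * y) (partialCount-eulerian n (suc k)) (partialCount-eulerian n k)

-- Rows of a DPP without special parts

×-irrelevant : ∀ {A B : Set} → Irrelevant A → Irrelevant B → Irrelevant (A × B)
×-irrelevant irrA irrB (a , b) (a′ , b′) = cong₂ _,_ (irrA a a′) (irrB b b′)

Σ-≡ : ∀ {D : Set} {P : D → Set} → (∀ d → Irrelevant (P d)) → {x y : Σ D P} → proj₁ x ≡ proj₁ y → x ≡ y
Σ-≡ irr {d , p} {.d , q} refl = cong (d ,_) (irr d p q)

-- head₀ [] = 0, so that length r < head₀ r also forces r to be nonempty.
head₀ : List ℕ → ℕ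
head₀ []      = 0
head₀ (x ∷ _) = x

head₀-≤ : ∀ {v} xs → All (_≤ v) xs → head₀ xs ≤ v
head₀-≤ []       _       = z≤n
head₀-≤ (x ∷ xs) (p ∷ _) = p

NonIncreasing : List ℕ → Set
NonIncreasing = Linked _≥_

NonIncreasing-irrelevant : ∀ xs → Irrelevant (NonIncreasing xs)
NonIncreasing-irrelevant _ = Linked.irrelevant ≤-irrelevant

nonIncreasing-≤-head : ∀ {x xs} → NonIncreasing (x ∷ xs) → All (_≤ x) (x ∷ xs)
nonIncreasing-≤-head = Linked⇒All (λ y≤x z≤y → ≤-trans z≤y y≤x) ≤-refl

Under : List ℕ → List ℕ → Set
Under []       _        = ⊤
Under (_ ∷ _)  []       = ⊤
Under (x ∷ xs) (y ∷ ys) = x < y × Under xs ys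

Under-irrelevant : ∀ xs ys → Irrelevant (Under xs ys)
Under-irrelevant []       ys       _ _ = refl
Under-irrelevant (x ∷ xs) []       _ _ = refl
Under-irrelevant (x ∷ xs) (y ∷ ys) = ×-irrelevant ≤-irrelevant (Under-irrelevant xs ys)

-- For a weakly decreasing row, having no special part means that every entry is at least the
-- length of the row; the last conjunct is condition (3).
Row : List ℕ → Set
Row r = NonIncreasing r × All (length r ≤_) r × length r < head₀ r

Row-irrelevant : ∀ r → Irrelevant (Row r)
Row-irrelevant r = ×-irrelevant (NonIncreasing-irrelevant r)
  (×-irrelevant (All.irrelevant ≤-irrelevant) ≤-irrelevant)

-- Condition (2) between a row consisting of s entries larger than all of nx followed by r, and
-- the row nx below it.
UnderAfter : ℕ → List ℕ → List ℕ → Set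
UnderAfter zero    nx r = Under nx (drop 1 r)
UnderAfter (suc s) nx r = Under (drop s nx) r

UnderNext : ℕ → List ℕ → Array → Set
UnderNext s r []       = ⊤
UnderNext s r (nx ∷ _) = UnderAfter s nx r

UnderNext-irrelevant : ∀ s r rows → Irrelevant (UnderNext s r rows)
UnderNext-irrelevant s       r []       _ _ = refl
UnderNext-irrelevant zero    r (nx ∷ _) = Under-irrelevant nx (drop 1 r)
UnderNext-irrelevant (suc s) r (nx ∷ _) = Under-irrelevant (drop s nx) r

-- The rows of a DPP without special parts whose first row has entries at most B; condition (4)
-- bounds every later row by the length of the row above.
Rows : ℕ → Array → Set
Rows B []         = ⊤
Rows B (r ∷ rest) = Row r × All (_≤ B) r × UnderNext 0 r rest × Rows (length r) rest

Rows-irrelevant : ∀ B a → Irrelevant (Rows B a)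
Rows-irrelevant B []         _ _ = refl
Rows-irrelevant B (r ∷ rest) = ×-irrelevant (Row-irrelevant r)
  (×-irrelevant (All.irrelevant ≤-irrelevant)
  (×-irrelevant (UnderNext-irrelevant 0 r rest) (Rows-irrelevant (length r) rest)))

length<bound : ∀ {B r} → Row r → All (_≤ B) r → length r < B
length<bound {r = r} (_ , _ , len<head) r≤B = ≤-trans len<head (head₀-≤ r r≤B)

1≤length : ∀ r → length r < head₀ r → 1 ≤ length r
1≤length (_ ∷ _) _ = s≤s z≤n

-- The conditions of a DPP, one row at a time

allBelow : ℕ → (ℕ → Bool) → Bool
allBelow zero    q = true
allBelow (suc m) q = q 0 ∧ allBelow m (q ∘ suc)

allBelow-cong : ∀ m {q q′} → (∀ i → q i ≡ q′ i) → allBelow m q ≡ allBelow m q′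
allBelow-cong zero    _    = refl
allBelow-cong (suc m) q≗q′ = cong₂ _∧_ (q≗q′ 0) (allBelow-cong m (q≗q′ ∘ suc))

allBelow-true : ∀ m → T (allBelow m (λ _ → true))
allBelow-true zero    = tt
allBelow-true (suc m) = allBelow-true m

allL-map-applyUpTo : ∀ p (g f : ℕ → ℕ) m → allL p (map g (applyUpTo f m)) ≡ allBelow m (λ i → p (g (f i)))
allL-map-applyUpTo p g f zero    = refl
allL-map-applyUpTo p g f (suc m) = cong (p (g (f 0)) ∧_) (allL-map-applyUpTo p g (f ∘ suc) m)

allIn≡allBelow : ∀ lo hi p → allIn lo hi p ≡ allBelow (suc hi ∸ lo) (λ i → p (lo + i))
allIn≡allBelow lo hi p = allL-map-applyUpTo p (lo +_) id (suc hi ∸ lo)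

allIn-cong : ∀ lo hi {p q} → (∀ j → p j ≡ q j) → allIn lo hi p ≡ allIn lo hi q
allIn-cong lo hi {p} {q} p≗q = allIn≡allBelow lo hi p
  ⟨ trans ⟩ allBelow-cong (suc hi ∸ lo) (p≗q ∘ (lo +_)) ⟨ trans ⟩ sym (allIn≡allBelow lo hi q)

allIn-suc : ∀ lo hi p → allIn (suc lo) (suc hi) p ≡ allIn lo hi (p ∘ suc)
allIn-suc lo hi p = allIn≡allBelow (suc lo) (suc hi) p ⟨ trans ⟩ sym (allIn≡allBelow lo hi (p ∘ suc))

allIn-suc-∸1 : ∀ lo hi p → allIn (suc (suc lo)) hi p ≡ allIn (suc lo) (hi ∸ 1) (p ∘ suc)
allIn-suc-∸1 lo hi p = allIn≡allBelow (suc (suc lo)) hi p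
  ⟨ trans ⟩ cong (λ m → allBelow m (λ i → p (suc (suc lo) + i))) (sym (∸-+-assoc hi 1 lo))
  ⟨ trans ⟩ sym (allIn≡allBelow (suc lo) (hi ∸ 1) (p ∘ suc))

allIn-∷ : ∀ lo hi {p q} → lo ≤ suc hi → (∀ i → p (suc lo + i) ≡ q (lo + i)) →
  allIn lo (suc hi) p ≡ p lo ∧ allIn lo hi q
allIn-∷ lo hi {p} {q} lo≤ shift = begin
  allIn lo (suc hi) p                                          ≡⟨ allIn≡allBelow lo (suc hi) p ⟩
  allBelow (suc (suc hi) ∸ lo) (λ i → p (lo + i))              ≡⟨ cong (λ m → allBelow m (λ i → p (lo + i))) (+-∸-assoc 1 lo≤) ⟩
  p (lo + 0) ∧ allBelow (suc hi ∸ lo) (λ i → p (lo + suc i))   ≡⟨ cong₂ _∧_ (cong p (+-identityʳ lo))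
                                                                    (allBelow-cong (suc hi ∸ lo) (λ i → cong p (+-suc lo i) ⟨ trans ⟩ shift i)) ⟩
  p lo ∧ allBelow (suc hi ∸ lo) (λ i → q (lo + i))             ≡⟨ cong (p lo ∧_) (sym (allIn≡allBelow lo hi q)) ⟩
  p lo ∧ allIn lo hi q                                          ∎
  where open ≡-Reasoning

cond2ʳ cond2ᶜ : Array → Bool
cond2ʳ a = allIn 1 (nrows a) λ i → allIn i (μ a i ∸ 1) λ j → ent a i (suc j) ≤ᵇ ent a i j
cond2ᶜ a = allIn 1 (nrows a ∸ 1) λ i → allIn (suc i) (μ a (suc i)) λ j →
  (j ≤ᵇ μ a i) ⇒ᵇ (ent a (suc i) j <ᵇ ent a i j)

positiveᵇ : List ℕ → Bool
positiveᵇ r = (1 ≤ᵇ length r) ∧ allL (1 ≤ᵇ_) r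

longerᵇ : List ℕ → Array → Bool
longerᵇ r []      = true
longerᵇ r (s ∷ _) = suc (length s) ≤ᵇ length r

nonIncreasingᵇ : List ℕ → Bool
nonIncreasingᵇ r = allBelow (length r ∸ 1) (λ k → nth 0 r (suc k) ≤ᵇ nth 0 r k)

underNextᵇ : List ℕ → Array → Bool
underNextᵇ r []      = true
underNextᵇ r (s ∷ _) = allBelow (length s) (λ k → (2 + k ≤ᵇ length r) ⇒ᵇ (nth 0 s k <ᵇ nth 0 r (suc k)))

nextHeadᵇ : List ℕ → Array → Bool
nextHeadᵇ r []      = true
nextHeadᵇ r (s ∷ _) = head₀ s ≤ᵇ length r

noSpecialFromᵇ : ℕ → List ℕ → Bool
noSpecialFromᵇ o r = allBelow (length r) (λ k → not (nth 0 r k ≤ᵇ o + k))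

nth-0≡head₀ : ∀ r → nth 0 r 0 ≡ head₀ r
nth-0≡head₀ []      = refl
nth-0≡head₀ (x ∷ r) = refl

allIn-row : ∀ p r → allIn 1 (length r) (λ j → p (nth 0 r (j ∸ 1))) ≡ allL p r
allIn-row p r = allIn≡allBelow 1 (length r) _ ⟨ trans ⟩ go r
  where
  go : ∀ r → allBelow (length r) (λ i → p (nth 0 r i)) ≡ allL p r
  go []      = refl
  go (x ∷ r) = cong (p x ∧_) (go r)

≤ᵇ-suc : ∀ m n → (suc m ≤ᵇ suc n) ≡ (m ≤ᵇ n)
≤ᵇ-suc zero    n = refl
≤ᵇ-suc (suc m) n = refl

wellShaped-∷ : ∀ r rest → wellShaped (r ∷ rest) ≡ positiveᵇ r ∧ wellShaped rest
wellShaped-∷ r rest = allIn-∷ 1 (length rest) z<s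
    (λ i → cong ((1 ≤ᵇ length (nth [] rest i)) ∧_) (allIn-suc (suc i) _ _))
  ⟨ trans ⟩ cong (λ b → ((1 ≤ᵇ length r) ∧ b) ∧ wellShaped rest) (allIn-row (1 ≤ᵇ_) r)

cond1-∷ : ∀ r rest → cond1 (r ∷ rest) ≡ longerᵇ r rest ∧ cond1 rest
cond1-∷ r []        = refl
cond1-∷ r (s ∷ rest) = allIn-∷ 1 (length rest) z<s (λ i → ≤ᵇ-suc (μ (s ∷ rest) (2 + i)) (μ (s ∷ rest) (suc i)))

cond2ʳ-∷ : ∀ r rest → cond2ʳ (r ∷ rest) ≡ nonIncreasingᵇ r ∧ cond2ʳ rest
cond2ʳ-∷ r rest = allIn-∷ 1 (length rest) z<s (λ i → allIn-suc-∸1 i (μ (r ∷ rest) (2 + i) ∸ 1) (λ j → ent (r ∷ rest) (2 + i) (suc j) ≤ᵇ ent (r ∷ rest) (2 + i) j))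
  ⟨ trans ⟩ cong (_∧ cond2ʳ rest) (allIn≡allBelow 1 (length r ∸ 1) _)

cond2ᶜ-∷ : ∀ r rest → cond2ᶜ (r ∷ rest) ≡ underNextᵇ r rest ∧ cond2ᶜ rest
cond2ᶜ-∷ r []        = refl
cond2ᶜ-∷ r (s ∷ rest) = allIn-∷ 1 (length rest) z<s
    (λ i → allIn-suc (suc (suc i)) (μ (s ∷ rest) (2 + i)) _
           ⟨ trans ⟩ allIn-cong (suc (suc i)) (μ (s ∷ rest) (2 + i))
                       (λ j → cong (_⇒ᵇ (ent (s ∷ rest) (2 + i) j <ᵇ ent (s ∷ rest) (suc i) j)) (≤ᵇ-suc j (μ (s ∷ rest) (suc i)))))
  ⟨ trans ⟩ cong (_∧ cond2ᶜ (s ∷ rest)) (allIn≡allBelow 2 (suc (length s)) _)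

cond3-∷ : ∀ r rest → cond3 (r ∷ rest) ≡ (length r <ᵇ head₀ r) ∧ cond3 rest
cond3-∷ r rest = allIn-∷ 1 (length rest) z<s (λ i → refl)
  ⟨ trans ⟩ cong (λ h → (length r <ᵇ h) ∧ cond3 rest) (nth-0≡head₀ r)

cond4-∷ : ∀ r rest → cond4 (r ∷ rest) ≡ nextHeadᵇ r rest ∧ cond4 rest
cond4-∷ r []        = refl
cond4-∷ r (s ∷ rest) = allIn-∷ 2 (suc (length rest)) (s≤s z<s) (λ i → refl)
  ⟨ trans ⟩ cong₂ (λ h L → (h ≤ᵇ L) ∧ cond4 (s ∷ rest)) (nth-0≡head₀ s) (m+n∸n≡m (length r) 2)

hasOrder-∷ : ∀ n r rest → hasOrder n (r ∷ rest) ≡ allL (_≤ᵇ n) r ∧ hasOrder n rest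
hasOrder-∷ n r rest = allIn-∷ 1 (length rest) z<s (λ i → allIn-suc (suc i) _ _)
  ⟨ trans ⟩ cong (_∧ hasOrder n rest) (allIn-row (_≤ᵇ n) r)

noSpecialPart-∷ : ∀ r rest → noSpecialPart (r ∷ rest) ≡ noSpecialFromᵇ 0 r ∧ noSpecialPart rest
noSpecialPart-∷ r rest = allIn-∷ 1 (length rest) z<s (λ i → allIn-suc (suc i) _ _)
  ⟨ trans ⟩ cong (_∧ noSpecialPart rest) (allIn≡allBelow 1 (length r) _)

∧-split : ∀ x {y} → T (x ∧ y) → T x × T y
∧-split x = Equivalence.to (T-∧ {x})

∧-join : ∀ x {y} → T x → T y → T (x ∧ y)
∧-join x p q = Equivalence.from (T-∧ {x}) (p , q)

T-split : ∀ {x} y {z} → x ≡ y ∧ z → T x → T y × T z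
T-split y e = ∧-split y ∘ subst T e

T-join : ∀ {x} y {z} → x ≡ y ∧ z → T y → T z → T x
T-join y e p q = subst T (sym e) (∧-join y p q)

record Conditions (n : ℕ) (a : Array) : Set where
  constructor mkConditions
  field
    wellShaped✓    : T (wellShaped a)
    cond1✓         : T (cond1 a)
    cond2ʳ✓        : T (cond2ʳ a)
    cond2ᶜ✓        : T (cond2ᶜ a)
    cond3✓         : T (cond3 a)
    cond4✓         : T (cond4 a)
    hasOrder✓      : T (hasOrder n a)
    noSpecialPart✓ : T (noSpecialPart a)

isDPP⇒conditions : ∀ {n} a → T (isDPP a) → T (hasOrder n a) → T (noSpecialPart a) → Conditions n a
isDPP⇒conditions a d h s = mkConditions (proj₁ w) (proj₁ c1) (proj₁ c2) (proj₂ c2) (proj₁ c34) (proj₂ c34) h s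
  where
  w   = ∧-split (wellShaped a) d
  c1  = ∧-split (cond1 a) (proj₂ w)
  c2′ = ∧-split (cond2 a) (proj₂ c1)
  c2  = ∧-split (cond2ʳ a) (proj₁ c2′)
  c34 = ∧-split (cond3 a) (proj₂ c2′)

conditions⇒isDPP : ∀ {n} a → Conditions n a → T (isDPP a)
conditions⇒isDPP a (mkConditions w c1 c2ʳ c2ᶜ c3 c4 _ _) =
  ∧-join (wellShaped a) w (∧-join (cond1 a) c1 (∧-join (cond2 a) (∧-join (cond2ʳ a) c2ʳ c2ᶜ) (∧-join (cond3 a) c3 c4)))

record FirstRowConditions (n : ℕ) (r : List ℕ) (rest : Array) : Set where
  constructor mkFirstRowConditions
  field
    positive✓      : T (positiveᵇ r)
    longer✓        : T (longerᵇ r rest)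
    nonIncreasing✓ : T (nonIncreasingᵇ r)
    underNext✓     : T (underNextᵇ r rest)
    length<head✓   : T (length r <ᵇ head₀ r)
    nextHead✓      : T (nextHeadᵇ r rest)
    order✓         : T (allL (_≤ᵇ n) r)
    noSpecial✓     : T (noSpecialFromᵇ 0 r)

conditions-∷⁻ : ∀ {n r rest} → Conditions n (r ∷ rest) → FirstRowConditions n r rest × Conditions n rest
conditions-∷⁻ {n} {r} {rest} (mkConditions w c1 c2ʳ c2ᶜ c3 c4 h s) =
  mkFirstRowConditions (proj₁ w′) (proj₁ c1′) (proj₁ c2ʳ′) (proj₁ c2ᶜ′) (proj₁ c3′) (proj₁ c4′) (proj₁ h′) (proj₁ s′) ,
  mkConditions (proj₂ w′) (proj₂ c1′) (proj₂ c2ʳ′) (proj₂ c2ᶜ′) (proj₂ c3′) (proj₂ c4′) (proj₂ h′) (proj₂ s′)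
  where
  w′   = T-split (positiveᵇ r)          (wellShaped-∷ r rest)     w
  c1′  = T-split (longerᵇ r rest)       (cond1-∷ r rest)          c1
  c2ʳ′ = T-split (nonIncreasingᵇ r)     (cond2ʳ-∷ r rest)         c2ʳ
  c2ᶜ′ = T-split (underNextᵇ r rest)    (cond2ᶜ-∷ r rest)         c2ᶜ
  c3′  = T-split (length r <ᵇ head₀ r)  (cond3-∷ r rest)          c3
  c4′  = T-split (nextHeadᵇ r rest)     (cond4-∷ r rest)          c4
  h′   = T-split (allL (_≤ᵇ n) r)       (hasOrder-∷ n r rest)     h
  s′   = T-split (noSpecialFromᵇ 0 r)   (noSpecialPart-∷ r rest)  s

conditions-∷⁺ : ∀ {n r rest} → FirstRowConditions n r rest → Conditions n rest → Conditions n (r ∷ rest)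
conditions-∷⁺ {n} {r} {rest} (mkFirstRowConditions w c1 c2ʳ c2ᶜ c3 c4 h s) (mkConditions w′ c1′ c2ʳ′ c2ᶜ′ c3′ c4′ h′ s′) =
  mkConditions (T-join (positiveᵇ r)         (wellShaped-∷ r rest)    w   w′)
               (T-join (longerᵇ r rest)      (cond1-∷ r rest)         c1  c1′)
               (T-join (nonIncreasingᵇ r)    (cond2ʳ-∷ r rest)        c2ʳ c2ʳ′)
               (T-join (underNextᵇ r rest)   (cond2ᶜ-∷ r rest)        c2ᶜ c2ᶜ′)
               (T-join (length r <ᵇ head₀ r) (cond3-∷ r rest)         c3  c3′)
               (T-join (nextHeadᵇ r rest)    (cond4-∷ r rest)         c4  c4′)
               (T-join (allL (_≤ᵇ n) r)      (hasOrder-∷ n r rest)    h   h′)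
               (T-join (noSpecialFromᵇ 0 r)  (noSpecialPart-∷ r rest) s   s′)

T-nonIncreasingᵇ : ∀ r → T (nonIncreasingᵇ r) ⇔ NonIncreasing r
T-nonIncreasingᵇ r = mk⇔ (to r) from
  where
  to : ∀ r → T (nonIncreasingᵇ r) → NonIncreasing r
  to []           _ = []
  to (x ∷ [])     _ = [-]
  to (x ∷ y ∷ ys) h = ≤ᵇ⇒≤ y x (proj₁ p) ∷ to (y ∷ ys) (proj₂ p)
    where p = ∧-split (y ≤ᵇ x) h
  from : ∀ {r} → NonIncreasing r → T (nonIncreasingᵇ r)
  from []                           = tt
  from [-]                          = tt
  from (_∷_ {x} {y} y≤x h) = ∧-join (y ≤ᵇ x) (≤⇒≤ᵇ y≤x) (from h)

underᵇ : List ℕ → List ℕ → Bool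
underᵇ s t = allBelow (length s) (λ k → (k <ᵇ length t) ⇒ᵇ (nth 0 s k <ᵇ nth 0 t k))

T-underᵇ : ∀ s t → T (underᵇ s t) ⇔ Under s t
T-underᵇ s t = mk⇔ (to s t) (from s t)
  where
  to : ∀ s t → T (underᵇ s t) → Under s t
  to []       t        _ = tt
  to (y ∷ ys) []       _ = tt
  to (y ∷ ys) (z ∷ zs) h = <ᵇ⇒< y z (proj₁ p) , to ys zs (proj₂ p)
    where p = ∧-split (y <ᵇ z) h
  from : ∀ s t → Under s t → T (underᵇ s t)
  from []       t        _         = tt
  from (y ∷ ys) []       _         = allBelow-true (suc (length ys))
  from (y ∷ ys) (z ∷ zs) (y<z , u) = ∧-join (y <ᵇ z) (<⇒<ᵇ y<z) (from ys zs u)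

T-underNextᵇ : ∀ r rest → T (underNextᵇ r rest) ⇔ UnderNext 0 r rest
T-underNextᵇ r       []       = mk⇔ (λ _ → tt) (λ _ → tt)
T-underNextᵇ []      (s ∷ _)  = T-underᵇ s []
T-underNextᵇ (x ∷ t) (s ∷ _)  = T-underᵇ s t

T-allL : ∀ p xs → T (allL p xs) ⇔ All (T ∘ p) xs
T-allL p xs = mk⇔ (to xs) (from xs)
  where
  to : ∀ xs → T (allL p xs) → All (T ∘ p) xs
  to []       _ = []
  to (x ∷ xs) h = proj₁ q ∷ to xs (proj₂ q)
    where q = ∧-split (p x) h
  from : ∀ xs → All (T ∘ p) xs → T (allL p xs)
  from []       []       = tt
  from (x ∷ xs) (q ∷ qs) = ∧-join (p x) q (from xs qs)

T-not-≤ᵇ : ∀ x m → T (not (x ≤ᵇ m)) ⇔ m < x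
T-not-≤ᵇ x m = mk⇔ to from
  where
  to : T (not (x ≤ᵇ m)) → m < x
  to h = ≰⇒> (λ x≤m → subst (T ∘ not) (Equivalence.to T-≡ (≤⇒≤ᵇ x≤m)) h)
  from : m < x → T (not (x ≤ᵇ m))
  from m<x = Equivalence.from T-not-≡ (¬-not (λ x≤ᵇm → <⇒≱ m<x (≤ᵇ⇒≤ x m (Equivalence.from T-≡ x≤ᵇm))))

noSpecialFromᵇ-∷ : ∀ o x r → noSpecialFromᵇ o (x ∷ r) ≡ not (x ≤ᵇ o) ∧ noSpecialFromᵇ (suc o) r
noSpecialFromᵇ-∷ o x r = cong₂ _∧_ (cong (λ z → not (x ≤ᵇ z)) (+-identityʳ o))
  (allBelow-cong (length r) (λ k → cong (λ z → not (nth 0 r k ≤ᵇ z)) (+-suc o k)))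

noSpecialFromᵇ⇒ : ∀ o r → NonIncreasing r → T (noSpecialFromᵇ o r) → All (o + length r ≤_) r
noSpecialFromᵇ⇒ o []           _         _ = []
noSpecialFromᵇ⇒ o (x ∷ [])     _         h =
  subst (_≤ x) (+-comm 1 o) (Equivalence.to (T-not-≤ᵇ x o) (proj₁ (T-split (not (x ≤ᵇ o)) (noSpecialFromᵇ-∷ o x []) h))) ∷ []
noSpecialFromᵇ⇒ o (x ∷ y ∷ ys) (y≤x ∷ ni) h = ≤-trans (≤-reflexive E) (≤-trans y-bound y≤x) ∷ All.map (≤-trans (≤-reflexive E)) ih
  where
  ih = noSpecialFromᵇ⇒ (suc o) (y ∷ ys) ni (proj₂ (T-split (not (x ≤ᵇ o)) (noSpecialFromᵇ-∷ o x (y ∷ ys)) h))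
  y-bound = All.head ih
  E : o + length (x ∷ y ∷ ys) ≡ suc o + length (y ∷ ys)
  E = +-suc o (length (y ∷ ys))

noSpecialFromᵇ⇐ : ∀ o r → All (o + length r ≤_) r → T (noSpecialFromᵇ o r)
noSpecialFromᵇ⇐ o []      []      = tt
noSpecialFromᵇ⇐ o (x ∷ r) (p ∷ ps) = T-join (not (x ≤ᵇ o)) (noSpecialFromᵇ-∷ o x r)
  (Equivalence.from (T-not-≤ᵇ x o) (≤-trans (s≤s (m≤m+n o (length r))) (≤-trans (≤-reflexive (sym (+-suc o (length r)))) p)))
  (noSpecialFromᵇ⇐ (suc o) r (All.map (≤-trans (≤-reflexive (sym (+-suc o (length r))))) ps))

HeadBounded : ℕ → Array → Set
HeadBounded B []      = ⊤
HeadBounded B (r ∷ _) = head₀ r ≤ B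

rows⇒conditions : ∀ {n B} a → B ≤ n → Rows B a → Conditions n a
rows⇒conditions []         _   _ = mkConditions tt tt tt tt tt tt tt tt
rows⇒conditions {n} (r ∷ rest) B≤n (isRow@(ni , tall , len<head) , r≤B , under , ok) =
  conditions-∷⁺ first (rows⇒conditions rest (<⇒≤ (≤-trans (length<bound isRow r≤B) B≤n)) ok)
  where
  nonempty = 1≤length r len<head
  first : FirstRowConditions n r rest
  first = mkFirstRowConditions
    (∧-join (1 ≤ᵇ length r) (≤⇒≤ᵇ nonempty) (Equivalence.from (T-allL _ r) (All.map (≤⇒≤ᵇ ∘ ≤-trans nonempty) tall)))
    (longer rest ok)
    (Equivalence.from (T-nonIncreasingᵇ r) ni)
    (Equivalence.from (T-underNextᵇ r rest) under)
    (<⇒<ᵇ len<head)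
    (nextHead rest ok)
    (Equivalence.from (T-allL _ r) (All.map (λ x≤B → ≤⇒≤ᵇ (≤-trans x≤B B≤n)) r≤B))
    (noSpecialFromᵇ⇐ 0 r tall)
    where
    longer : ∀ rest → Rows (length r) rest → T (longerᵇ r rest)
    longer []      _                  = tt
    longer (s ∷ _) (sRow , s≤ , _) = ≤⇒≤ᵇ (length<bound sRow s≤)
    nextHead : ∀ rest → Rows (length r) rest → T (nextHeadᵇ r rest)
    nextHead []      _           = tt
    nextHead (s ∷ _) (_ , s≤ , _) = ≤⇒≤ᵇ (head₀-≤ s s≤)

conditions⇒rows : ∀ {n B} a → Conditions n a → HeadBounded B a → Rows B a
conditions⇒rows []         _ _  = tt
conditions⇒rows {B = B} (r ∷ rest) C h≤B =
  (ni , noSpecialFromᵇ⇒ 0 r ni (noSpecial✓ F) , <ᵇ⇒< _ _ (length<head✓ F)) ,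
  bounded r ni h≤B ,
  Equivalence.to (T-underNextᵇ r rest) (underNext✓ F) ,
  conditions⇒rows rest C′ (nextHead rest (nextHead✓ F))
  where
  F  = proj₁ (conditions-∷⁻ C)
  C′ = proj₂ (conditions-∷⁻ C)
  open FirstRowConditions
  ni = Equivalence.to (T-nonIncreasingᵇ r) (nonIncreasing✓ F)
  bounded : ∀ r → NonIncreasing r → head₀ r ≤ B → All (_≤ B) r
  bounded []      _  _   = []
  bounded (x ∷ _) ni x≤B = All.map (λ y≤x → ≤-trans y≤x x≤B) (nonIncreasing-≤-head ni)
  nextHead : ∀ rest → T (nextHeadᵇ r rest) → HeadBounded (length r) rest
  nextHead []      _ = tt
  nextHead (s ∷ _) h = ≤ᵇ⇒≤ _ _ h

conditions⇒headBounded : ∀ {n} a → Conditions n a → HeadBounded n a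
conditions⇒headBounded []      _ = tt
conditions⇒headBounded (r ∷ _) C =
  head₀-≤ r (All.map (≤ᵇ⇒≤ _ _) (Equivalence.to (T-allL _ r) (FirstRowConditions.order✓ (proj₁ (conditions-∷⁻ C)))))

DPPRows : ℕ → ℕ → Set
DPPRows n k = Σ Array λ a → Rows n a × length a ≡ k

DPPRows-≡ : ∀ {n k} {x y : DPPRows n k} → proj₁ x ≡ proj₁ y → x ≡ y
DPPRows-≡ {n} = Σ-≡ (λ a → ×-irrelevant (Rows-irrelevant n a) ≡-irrelevant)

DPPNoSpecial↔DPPRows : ∀ n k → DPPNoSpecial n k ↔ DPPRows n k
DPPNoSpecial↔DPPRows n k = mk↔ₛ′ to from (λ _ → DPPRows-≡ refl)
  (λ _ → Σ-≡ (λ _ → ×-irrelevant T-irrelevant (×-irrelevant T-irrelevant (×-irrelevant T-irrelevant T-irrelevant))) refl)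
  where
  to : DPPNoSpecial n k → DPPRows n k
  to (a , dpp , order , rows≡k , noSpecial) =
    a , conditions⇒rows a C (conditions⇒headBounded a C) , ≡ᵇ⇒≡ (length a) k rows≡k
    where C = isDPP⇒conditions a dpp order noSpecial
  from : DPPRows n k → DPPNoSpecial n k
  from (a , ok , rows≡k) =
    a , conditions⇒isDPP a C , Conditions.hasOrder✓ C , ≡⇒≡ᵇ (length a) k rows≡k , Conditions.noSpecialPart✓ C
    where C = rows⇒conditions a ≤-refl ok

-- Reading a DPP from its largest entries downwards

nonIncreasing-++⁻ʳ : ∀ xs {ys} → NonIncreasing (xs ++ ys) → NonIncreasing ys
nonIncreasing-++⁻ʳ []       h = h
nonIncreasing-++⁻ʳ (x ∷ xs) h = nonIncreasing-++⁻ʳ xs (Linked.tail h)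

nonIncreasing-∷ : ∀ {x} ys → head₀ ys ≤ x → NonIncreasing ys → NonIncreasing (x ∷ ys)
nonIncreasing-∷ []       _ _ = [-]
nonIncreasing-∷ (y ∷ ys) p h = p ∷ h

nonIncreasing-replicate-++ : ∀ t {x} ys → head₀ ys ≤ x → NonIncreasing ys → NonIncreasing (replicate t x ++ ys)
nonIncreasing-replicate-++ zero          ys p h = h
nonIncreasing-replicate-++ (suc zero)    ys p h = nonIncreasing-∷ ys p h
nonIncreasing-replicate-++ (suc (suc t)) ys p h = ≤-refl ∷ nonIncreasing-replicate-++ (suc t) ys p h

nonIncreasing-replicate : ∀ t {x} → NonIncreasing (replicate t x)
nonIncreasing-replicate zero          = []
nonIncreasing-replicate (suc zero)    = [-]
nonIncreasing-replicate (suc (suc t)) = ≤-refl ∷ nonIncreasing-replicate (suc t)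

length-replicate-++ : ∀ t {x : ℕ} ys → length (replicate t x ++ ys) ≡ t + length ys
length-replicate-++ t ys = length-++ (replicate t _) ⟨ trans ⟩ cong (_+ length ys) (length-replicate t)

width-replicate-++ : ∀ s t {x : ℕ} zs → s + length (replicate t x ++ zs) ≡ s + t + length zs
width-replicate-++ s t zs = cong (s +_) (length-replicate-++ t zs) ⟨ trans ⟩ sym (+-assoc s t _)

countLeading : ℕ → List ℕ → ℕ
countLeading x []       = 0
countLeading x (y ∷ ys) = if y ≡ᵇ x then suc (countLeading x ys) else 0

dropLeading : ℕ → List ℕ → List ℕ
dropLeading x []       = []
dropLeading x (y ∷ ys) = if y ≡ᵇ x then dropLeading x ys else y ∷ ys

replicate-countLeading-++ : ∀ x ys → replicate (countLeading x ys) x ++ dropLeading x ys ≡ ys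
replicate-countLeading-++ x []       = refl
replicate-countLeading-++ x (y ∷ ys) with y ≡ᵇ x in eq
... | true rewrite ≡ᵇ⇒≡ y x (subst T (sym eq) tt) = cong (x ∷_) (replicate-countLeading-++ x ys)
... | false = refl

≡ᵇ-refl : ∀ n → (n ≡ᵇ n) ≡ true
≡ᵇ-refl zero    = refl
≡ᵇ-refl (suc n) = ≡ᵇ-refl n

≤⇒≢ᵇ-suc : ∀ {y v} → y ≤ v → (y ≡ᵇ suc v) ≡ false
≤⇒≢ᵇ-suc {zero}  _         = refl
≤⇒≢ᵇ-suc {suc y} (s≤s y≤v) = ≤⇒≢ᵇ-suc y≤v

countLeading-replicate-++ : ∀ {v} t zs → All (_≤ v) zs → countLeading (suc v) (replicate t (suc v) ++ zs) ≡ t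
countLeading-replicate-++ {v} (suc t) zs p rewrite ≡ᵇ-refl v = cong suc (countLeading-replicate-++ t zs p)
countLeading-replicate-++     zero    []       _       = refl
countLeading-replicate-++     zero    (z ∷ zs) (q ∷ _) rewrite ≤⇒≢ᵇ-suc q = refl

dropLeading-replicate-++ : ∀ {v} t zs → All (_≤ v) zs → dropLeading (suc v) (replicate t (suc v) ++ zs) ≡ zs
dropLeading-replicate-++ {v} (suc t) zs p rewrite ≡ᵇ-refl v = dropLeading-replicate-++ t zs p
dropLeading-replicate-++     zero    []       _       = refl
dropLeading-replicate-++     zero    (z ∷ zs) (q ∷ _) rewrite ≤⇒≢ᵇ-suc q = refl

dropLeading-≤ : ∀ {v} ys → NonIncreasing ys → All (_≤ suc v) ys → All (_≤ v) (dropLeading (suc v) ys)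
dropLeading-≤ []       _ _ = []
dropLeading-≤ {v} (y ∷ ys) h (y≤1+v ∷ p) with y ≡ᵇ suc v in eq
... | true  = dropLeading-≤ ys (Linked.tail h) p
... | false = All.map (λ z≤y → ≤-trans z≤y y≤v) (nonIncreasing-≤-head h)
  where
  y≤v : y ≤ v
  y≤v = ≤-pred (≤∧≢⇒< y≤1+v (λ y≡1+v → subst T eq (≡⇒≡ᵇ y (suc v) y≡1+v)))

≡-replicate : ∀ {X} xs → All (X ≤_) xs → All (_≤ X) xs → xs ≡ replicate (length xs) X
≡-replicate []       _       _       = refl
≡-replicate (x ∷ xs) (p ∷ P) (q ∷ Q) = cong₂ _∷_ (≤-antisym q p) (≡-replicate xs P Q)

drop-suc : ∀ {A : Set} n (xs : List A) → drop (suc n) xs ≡ drop 1 (drop n xs)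
drop-suc zero    xs       = refl
drop-suc (suc n) []       = refl
drop-suc (suc n) (x ∷ xs) = drop-suc n xs

drop-replicate-++ : ∀ {X : ℕ} s c zs → c ≤ s → drop s (replicate c X ++ zs) ≡ drop (s ∸ c) zs
drop-replicate-++ s       zero    zs _         = refl
drop-replicate-++ (suc s) (suc c) zs (s≤s c≤s) = drop-replicate-++ s c zs c≤s

under-replicate : ∀ {X} ys d → All (_< X) ys → Under ys (replicate d X)
under-replicate []       d       _       = tt
under-replicate (y ∷ ys) zero    _       = tt
under-replicate (y ∷ ys) (suc d) (p ∷ q) = p , under-replicate ys d q

under-∷⁻ : ∀ {X} ys {ws} → Under ys (X ∷ ws) → Under (drop 1 ys) ws
under-∷⁻ []       _       = tt
under-∷⁻ (y ∷ ys) (_ , p) = p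

under-∷⁺ : ∀ {X ys ws} → All (_< X) ys → Under (drop 1 ys) ws → Under ys (X ∷ ws)
under-∷⁺ []      _ = tt
under-∷⁺ (q ∷ _) p = q , p

underAfter-∷⁻ : ∀ {X ws} s nx → UnderAfter s nx (X ∷ ws) → UnderAfter (suc s) nx ws
underAfter-∷⁻ zero    nx p = p
underAfter-∷⁻ (suc s) nx p = subst (λ z → Under z _) (sym (drop-suc s nx)) (under-∷⁻ (drop s nx) p)

underAfter-∷⁺ : ∀ {X ws} s {nx} → All (_< X) nx → UnderAfter (suc s) nx ws → UnderAfter s nx (X ∷ ws)
underAfter-∷⁺ zero    q p = p
underAfter-∷⁺ (suc s) {nx} q p = under-∷⁺ (drop⁺ s q) (subst (λ z → Under z _) (drop-suc s nx) p)

underAfter-replicate-++⁻ : ∀ {X zs} s t nx → UnderAfter s nx (replicate t X ++ zs) → UnderAfter (s + t) nx zs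
underAfter-replicate-++⁻ {zs = zs} s zero    nx p = subst (λ z → UnderAfter z nx zs) (sym (+-identityʳ s)) p
underAfter-replicate-++⁻ {zs = zs} s (suc t) nx p = subst (λ z → UnderAfter z nx zs) (sym (+-suc s t))
  (underAfter-replicate-++⁻ (suc s) t nx (underAfter-∷⁻ s nx p))

underAfter-replicate-++⁺ : ∀ {X zs} s t {nx} → All (_< X) nx → UnderAfter (s + t) nx zs → UnderAfter s nx (replicate t X ++ zs)
underAfter-replicate-++⁺ {zs = zs} s zero {nx} q p = subst (λ z → UnderAfter z nx zs) (+-identityʳ s) p
underAfter-replicate-++⁺ {zs = zs} s (suc t) {nx} q p = underAfter-∷⁺ s q
  (underAfter-replicate-++⁺ (suc s) t q (subst (λ z → UnderAfter z nx zs) (+-suc s t) p))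

underNext-replicate-++⁻ : ∀ {X zs} s t rows → UnderNext s (replicate t X ++ zs) rows → UnderNext (s + t) zs rows
underNext-replicate-++⁻ s t []       _ = tt
underNext-replicate-++⁻ s t (nx ∷ _) p = underAfter-replicate-++⁻ s t nx p

next-row-< : ∀ {v L nx rows} → L ≤ v → Rows L (nx ∷ rows) → All (_< suc v) nx
next-row-< L≤v (_ , nx≤L , _) = All.map (λ p → s≤s (≤-trans p L≤v)) nx≤L

underNext-replicate-++⁺ : ∀ {v L zs} s t rows → L ≤ v → Rows L rows →
  UnderNext (s + t) zs rows → UnderNext s (replicate t (suc v) ++ zs) rows
underNext-replicate-++⁺ s t []       _   _  _ = tt
underNext-replicate-++⁺ s t (nx ∷ _) L≤v ok p = underAfter-replicate-++⁺ s t (next-row-< L≤v ok) p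

leading≤ : ∀ {X} s c zs {w ws} → Under (drop s (replicate c X ++ zs)) (w ∷ ws) → w ≤ X → c ≤ s
leading≤ s       zero    zs _         _   = z≤n
leading≤ zero    (suc c) zs (X<w , _) w≤X = ⊥-elim (<-irrefl refl (<-≤-trans X<w w≤X))
leading≤ (suc s) (suc c) zs p         w≤X = s≤s (leading≤ s c zs p w≤X)

HeadAbove : ℕ → ℕ → List ℕ → Set
HeadAbove zero    L tl = L < head₀ tl
HeadAbove (suc _) L tl = ⊤

HeadAbove-irrelevant : ∀ s L tl → Irrelevant (HeadAbove s L tl)
HeadAbove-irrelevant zero    L tl = ≤-irrelevant
HeadAbove-irrelevant (suc s) L tl _ _ = refl

headAbove-replicate-++⁻ : ∀ s t {L X zs} → HeadAbove s L (replicate t X ++ zs) → HeadAbove (s + t) L zs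
headAbove-replicate-++⁻ (suc s) t       _ = tt
headAbove-replicate-++⁻ zero    (suc t) _ = tt
headAbove-replicate-++⁻ zero    zero    p = p

headAbove-replicate-++⁺ : ∀ s t {L v zs} → L ≤ v → HeadAbove (s + t) L zs → HeadAbove s L (replicate t (suc v) ++ zs)
headAbove-replicate-++⁺ (suc s) t       _   _ = tt
headAbove-replicate-++⁺ zero    (suc t) L≤v _ = s≤s L≤v
headAbove-replicate-++⁺ zero    zero    _   p = p

-- What is left of a DPP without special parts once its entries larger than v have been read: the
-- current row consists of s such entries followed by tl, and rows are the rows below it.
record Residual (v s : ℕ) (tl : List ℕ) (rows : Array) : Set where
  constructor mkResidual
  field
    nonincreasing : NonIncreasing tl
    entries≤v     : All (_≤ v) tl
    width≤v       : s + length tl ≤ v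
    width≤entries : All (s + length tl ≤_) tl
    head>width    : HeadAbove s (s + length tl) tl
    next-under    : UnderNext s tl rows
    rows-below    : Rows (s + length tl) rows
open Residual

Residual-irrelevant : ∀ {v s tl rows} → Irrelevant (Residual v s tl rows)
Residual-irrelevant {v} {s} {tl} {rows} (mkResidual a b c d e f g) (mkResidual a′ b′ c′ d′ e′ f′ g′)
  rewrite NonIncreasing-irrelevant tl a a′ | All.irrelevant ≤-irrelevant b b′ | ≤-irrelevant c c′
        | All.irrelevant ≤-irrelevant d d′ | HeadAbove-irrelevant s _ tl e e′
        | UnderNext-irrelevant s tl rows f f′ | Rows-irrelevant _ rows g g′ = refl

residual₀-width<v : ∀ {v tl rows} → Residual v 0 tl rows → length tl < v
residual₀-width<v {tl = tl} R = ≤-trans (head>width R) (head₀-≤ tl (entries≤v R))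

rows⇒residual : ∀ {v r rows} → Rows v (r ∷ rows) → Residual v 0 r rows
rows⇒residual (isRow@(ni , tall , len<head) , r≤v , under , ok) = record
  { nonincreasing = ni ; entries≤v = r≤v ; width≤v = <⇒≤ (length<bound isRow r≤v)
  ; width≤entries = tall ; head>width = len<head ; next-under = under ; rows-below = ok }

residual⇒rows : ∀ {v r rows} → Residual v 0 r rows → Rows v (r ∷ rows)
residual⇒rows R = (nonincreasing R , width≤entries R , head>width R) , entries≤v R , next-under R , rows-below R

residual-lower : ∀ {v s} t {zs rows} → Residual (suc v) s (replicate t (suc v) ++ zs) rows →
  s + length (replicate t (suc v) ++ zs) ≤ v → All (_≤ v) zs → Residual v (s + t) zs rows
residual-lower {v} {s} t {zs} {rows} R w≤v zs≤v = record
  { nonincreasing = nonIncreasing-++⁻ʳ (replicate t (suc v)) (nonincreasing R)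
  ; entries≤v     = zs≤v
  ; width≤v       = subst (_≤ v) E w≤v
  ; width≤entries = subst (λ L → All (L ≤_) zs) E (++⁻ʳ (replicate t (suc v)) (width≤entries R))
  ; head>width    = subst (λ L → HeadAbove (s + t) L zs) E (headAbove-replicate-++⁻ s t (head>width R))
  ; next-under    = underNext-replicate-++⁻ s t rows (next-under R)
  ; rows-below    = subst (λ L → Rows L rows) E (rows-below R)
  }
  where
  E = width-replicate-++ s t zs

residual-raise : ∀ {v s} t {zs rows} → Residual v (s + t) zs rows → Residual (suc v) s (replicate t (suc v) ++ zs) rows
residual-raise {v} {s} t {zs} {rows} R = record
  { nonincreasing = nonIncreasing-replicate-++ t zs (m≤n⇒m≤1+n (head₀-≤ zs (entries≤v R))) (nonincreasing R)
  ; entries≤v     = ++⁺ (replicate⁺ t ≤-refl) (All.map m≤n⇒m≤1+n (entries≤v R))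
  ; width≤v       = subst (_≤ suc v) E (m≤n⇒m≤1+n (width≤v R))
  ; width≤entries = subst (λ L → All (L ≤_) xs) E (++⁺ (replicate⁺ t (m≤n⇒m≤1+n (width≤v R))) (width≤entries R))
  ; head>width    = subst (λ L → HeadAbove s L xs) E (headAbove-replicate-++⁺ s t (width≤v R) (head>width R))
  ; next-under    = underNext-replicate-++⁺ s t rows (width≤v R) (rows-below R) (next-under R)
  ; rows-below    = subst (λ L → Rows L rows) E (rows-below R)
  }
  where
  xs = replicate t (suc v) ++ zs
  E = sym (width-replicate-++ s t zs)

-- The states at threshold v with k rows left; with none left, no entry can have been read.
Partial : ℕ → ℕ → ℕ → Set
Partial v s zero    = s ≡ 0
Partial v s (suc j) = Σ (List ℕ × Array) λ (tl , rows) → Residual v s tl rows × length rows ≡ j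

Σ< : ℕ → (ℕ → Set) → Set
Σ< m F = Σ ℕ λ t → t < m × F t

Partial-≡ : ∀ {v s j} {x y : Partial v s (suc j)} → proj₁ x ≡ proj₁ y → x ≡ y
Partial-≡ = Σ-≡ (λ _ → ×-irrelevant Residual-irrelevant ≡-irrelevant)

Σ<Partial-≡ : ∀ {m v j} {f : ℕ → ℕ} {t t′ lt lt′} {x : Partial v (f t) (suc j)} {x′ : Partial v (f t′) (suc j)} →
  t ≡ t′ → proj₁ x ≡ proj₁ x′ → _≡_ {A = Σ< m (λ t → Partial v (f t) (suc j))} (t , lt , x) (t′ , lt′ , x′)
Σ<Partial-≡ refl e = cong₂ (λ lt x → _ , lt , x) (≤-irrelevant _ _) (Partial-≡ e)

Step : ℕ → ℕ → ℕ → Set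
Step v s j = Σ< (suc v ∸ s) (λ t → Partial v (s + t) (suc j)) ⊎ Σ< s (λ c → Partial v c j)

consume-leading : ∀ {v s j tl rows} → Residual (suc v) s tl rows → length rows ≡ j →
  s + length tl ≤ v → Σ< (suc v ∸ s) (λ t → Partial v (s + t) (suc j))
consume-leading {v} {s} {tl = tl} {rows} R len w≤v =
  t , +≤⇒<∸ (≤-trans (m≤m+n (s + t) (length zs)) (width≤v R′)) , (zs , rows) , R′ , len
  where
  t  = countLeading (suc v) tl
  zs = dropLeading (suc v) tl
  split = replicate-countLeading-++ (suc v) tl
  R′ = residual-lower t (subst (λ z → Residual (suc v) s z rows) (sym split) R)
         (subst (λ z → s + length z ≤ v) (sym split) w≤v)
         (dropLeading-≤ tl (nonincreasing R) (entries≤v R))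

width≡ : ∀ {v s tl rows} → Residual (suc v) s tl rows → ¬ (s + length tl ≤ v) → s + length tl ≡ suc v
width≡ R w≰v = ≤-antisym (width≤v R) (≰⇒> w≰v)

closed-row≡replicate : ∀ {v s′ tl rows} → Residual (suc v) (suc s′) tl rows → suc s′ + length tl ≡ suc v →
  tl ≡ replicate (v ∸ s′) (suc v)
closed-row≡replicate {v} {s′} {tl} R full = ≡-replicate tl
    (subst (λ L → All (L ≤_) tl) full (width≤entries R)) (entries≤v R)
  ⟨ trans ⟩ cong (λ n → replicate n (suc v)) (sym (m+n∸m≡n s′ (length tl)) ⟨ trans ⟩ cong (_∸ s′) (suc-injective full))

leading-copies≤ : ∀ {v s′ c zs} tl → s′ + length tl ≡ v → length (replicate c (suc v) ++ zs) ≤ v →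
  Under (drop s′ (replicate c (suc v) ++ zs)) tl → All (_≤ suc v) tl → c ≤ s′
leading-copies≤ {v} {s′} {c} {zs} [] full nx≤v _ _ = ≤-trans (m≤m+n c (length zs))
  (subst₂ _≤_ (length-replicate-++ c zs) (sym full ⟨ trans ⟩ +-identityʳ s′) nx≤v)
leading-copies≤ {s′ = s′} {c} {zs} (w ∷ _) _ _ under (w≤ ∷ _) = leading≤ s′ c zs under w≤

close-row : ∀ {v s j tl rows} → Residual (suc v) s tl rows → length rows ≡ j →
  ¬ (s + length tl ≤ v) → Σ< s (λ c → Partial v c j)
close-row {s = zero} R _ w≰v = ⊥-elim (w≰v (≤-pred (residual₀-width<v R)))
close-row {s = suc s′} {zero} {rows = []} R refl _ = 0 , s≤s z≤n , refl
close-row {v} {suc s′} {suc j} {tl} {nx ∷ rows} R len w≰v =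
  c , s≤s c≤s′ , (zs , rows) , residual-lower c (rows⇒residual ok′) (≤-pred (length<bound row′ nx′≤)) zs≤v , suc-injective len
  where
  full = width≡ R w≰v
  ok = subst (λ L → Rows L (nx ∷ rows)) full (rows-below R)
  c  = countLeading (suc v) nx
  zs = dropLeading (suc v) nx
  split = replicate-countLeading-++ (suc v) nx
  ok′ = subst (λ z → Rows (suc v) (z ∷ rows)) (sym split) ok
  row′ = proj₁ ok′
  nx′≤ = proj₁ (proj₂ ok′)
  zs≤v = dropLeading-≤ nx (proj₁ (proj₁ ok)) (proj₁ (proj₂ ok))
  under : Under (drop s′ (replicate c (suc v) ++ zs)) tl
  under = subst (λ z → Under (drop s′ z) tl) (sym split) (next-under R)
  c≤s′ : c ≤ s′
  c≤s′ = leading-copies≤ tl (suc-injective full) (≤-pred (length<bound row′ nx′≤)) under (entries≤v R)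

closed-width : ∀ {v s′} → s′ ≤ v → suc s′ + length (replicate (v ∸ s′) (suc v)) ≡ suc v
closed-width {v} {s′} s′≤v = cong suc (cong (s′ +_) (length-replicate (v ∸ s′)) ⟨ trans ⟩ m+[n∸m]≡n s′≤v)

closed-residual : ∀ {v s′} rows → s′ ≤ v → Rows (suc v) rows →
  UnderNext (suc s′) (replicate (v ∸ s′) (suc v)) rows → Residual (suc v) (suc s′) (replicate (v ∸ s′) (suc v)) rows
closed-residual {v} {s′} rows s′≤v ok under = record
  { nonincreasing = nonIncreasing-replicate (v ∸ s′)
  ; entries≤v     = replicate⁺ (v ∸ s′) ≤-refl
  ; width≤v       = subst (_≤ suc v) (sym W) ≤-refl
  ; width≤entries = subst (λ L → All (L ≤_) (replicate (v ∸ s′) (suc v))) (sym W) (replicate⁺ (v ∸ s′) ≤-refl)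
  ; head>width    = tt
  ; next-under    = under
  ; rows-below    = subst (λ L → Rows L rows) (sym W) ok
  }
  where
  W = closed-width s′≤v

peel : ∀ {v s j} → Partial (suc v) s (suc j) → Step v s j
peel {v} {s} ((tl , rows) , R , len) with s + length tl ≤? v
... | yes w≤v = inj₁ (consume-leading R len w≤v)
... | no  w≰v = inj₂ (close-row R len w≰v)

unpeel : ∀ {v s j} → s ≤ suc v → Step v s j → Partial (suc v) s (suc j)
unpeel {v} _ (inj₁ (t , _ , (zs , rows) , R , len)) = (replicate t (suc v) ++ zs , rows) , residual-raise t R , len
unpeel {v} {suc s′} {zero} s≤ (inj₂ (.0 , _ , refl)) =
  (replicate (v ∸ s′) (suc v) , []) , closed-residual [] (≤-pred s≤) tt tt , refl
unpeel {v} {suc s′} {suc j} s≤ (inj₂ (c , s≤s c≤s′ , (zs , rows) , R , len)) =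
  (replicate (v ∸ s′) (suc v) , nx ∷ rows) , closed-residual (nx ∷ rows) (≤-pred s≤) ok under , cong suc len
  where
  nx = replicate c (suc v) ++ zs
  ok = residual⇒rows (residual-raise c R)
  under : Under (drop s′ nx) (replicate (v ∸ s′) (suc v))
  under = subst (λ z → Under z (replicate (v ∸ s′) (suc v))) (sym (drop-replicate-++ s′ c zs c≤s′))
    (under-replicate (drop (s′ ∸ c) zs) (v ∸ s′) (drop⁺ (s′ ∸ c) (All.map s≤s (entries≤v R))))

unpeel-close-row : ∀ {v s j tl rows} (s≤ : s ≤ suc v) (R : Residual (suc v) s tl rows) (len : length rows ≡ j) w≰v →
  unpeel s≤ (inj₂ (close-row R len w≰v)) ≡ ((tl , rows) , R , len)
unpeel-close-row {s = zero} _ R _ w≰v = ⊥-elim (w≰v (≤-pred (residual₀-width<v R)))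
unpeel-close-row {s = suc s′} {zero} {rows = []} _ R refl w≰v =
  Partial-≡ (cong (_, []) (sym (closed-row≡replicate R (width≡ R w≰v))))
unpeel-close-row {v} {suc s′} {suc j} {rows = nx ∷ rows} _ R _ w≰v =
  Partial-≡ (cong₂ _,_ (sym (closed-row≡replicate R (width≡ R w≰v))) (cong (_∷ rows) (replicate-countLeading-++ (suc v) nx)))

unpeel-peel : ∀ {v s j} (s≤ : s ≤ suc v) (x : Partial (suc v) s (suc j)) → unpeel s≤ (peel x) ≡ x
unpeel-peel {v} {s} s≤ ((tl , rows) , R , len) with s + length tl ≤? v
... | yes _   = Partial-≡ (cong (_, rows) (replicate-countLeading-++ (suc v) tl))
... | no  w≰v = unpeel-close-row s≤ R len w≰v

peel-unpeel : ∀ {v s j} (s≤ : s ≤ suc v) (y : Step v s j) → peel (unpeel s≤ y) ≡ y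
peel-unpeel {v} {s} _ (inj₁ (t , _ , (zs , rows) , R , len)) with s + length (replicate t (suc v) ++ zs) ≤? v
... | yes _ = cong inj₁ (Σ<Partial-≡ (countLeading-replicate-++ t zs (entries≤v R))
                                     (cong (_, rows) (dropLeading-replicate-++ t zs (entries≤v R))))
... | no w≰v = ⊥-elim (w≰v (subst (_≤ v) (sym (width-replicate-++ s t zs)) (width≤v R)))
peel-unpeel {v} {suc s′} {zero} s≤ (inj₂ (.0 , _ , refl))
  with suc s′ + length (replicate (v ∸ s′) (suc v)) ≤? v
... | yes w≤v = ⊥-elim (1+n≰n (subst (_≤ v) (closed-width (≤-pred s≤)) w≤v))
... | no  _   = cong (λ lt → inj₂ (0 , lt , refl)) (≤-irrelevant _ _)
peel-unpeel {v} {suc s′} {suc j} s≤ (inj₂ (c , s≤s _ , (zs , rows) , R , len))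
  with suc s′ + length (replicate (v ∸ s′) (suc v)) ≤? v
... | yes w≤v = ⊥-elim (1+n≰n (subst (_≤ v) (closed-width (≤-pred s≤)) w≤v))
... | no  _   = cong inj₂ (Σ<Partial-≡ {f = id} (countLeading-replicate-++ c zs (entries≤v R))
                                       (cong (_, rows) (dropLeading-replicate-++ c zs (entries≤v R))))

step : ∀ {v s j} → s ≤ suc v → Partial (suc v) s (suc j) ↔ Step v s j
step s≤ = mk↔ₛ′ peel (unpeel s≤) (peel-unpeel s≤) (unpeel-peel s≤)

empty↔Fin0 : ∀ {A : Set} → ¬ A → A ↔ Fin 0
empty↔Fin0 ¬a = mk↔ₛ′ (⊥-elim ∘ ¬a) (λ ()) (λ ()) (⊥-elim ∘ ¬a)

singleton↔Fin1 : ∀ {A : Set} → Irrelevant A → A → A ↔ Fin 1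
singleton↔Fin1 irr a = mk↔ₛ′ (λ _ → Fin.zero) (λ _ → a) (λ { Fin.zero → refl ; (Fin.suc ()) }) (irr a)

Σ<-suc↔ : ∀ m {F : ℕ → Set} → Σ< (suc m) F ↔ (F 0 ⊎ Σ< m (F ∘ suc))
Σ<-suc↔ m {F} = mk↔ₛ′ to from to∘from from∘to
  where
  to : Σ< (suc m) F → F 0 ⊎ Σ< m (F ∘ suc)
  to (zero  , _       , x) = inj₁ x
  to (suc t , s≤s t<m , x) = inj₂ (t , t<m , x)
  from : F 0 ⊎ Σ< m (F ∘ suc) → Σ< (suc m) F
  from (inj₁ x)            = 0 , s≤s z≤n , x
  from (inj₂ (t , t<m , x)) = suc t , s≤s t<m , x
  to∘from : ∀ y → to (from y) ≡ y
  to∘from (inj₁ x) = refl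
  to∘from (inj₂ y) = refl
  from∘to : ∀ x → from (to x) ≡ x
  from∘to (zero  , s≤s z≤n , x) = refl
  from∘to (suc t , s≤s _   , x) = refl

Σ<↔Fin : ∀ m {F : ℕ → Set} {f : ℕ → ℕ} → (∀ t → t < m → F t ↔ Fin (f t)) → Σ< m F ↔ Fin (sumBelow m f)
Σ<↔Fin zero    _    = empty↔Fin0 (λ { (_ , () , _) })
Σ<↔Fin (suc m) F↔f = ↔-trans (Σ<-suc↔ m)
  (↔-trans (F↔f 0 z<s ⊎-↔ Σ<↔Fin m (λ t t<m → F↔f (suc t) (s<s t<m))) (↔-sym +↔⊎))

Partial↔Fin : ∀ v s k → s ≤ v → Partial v s k ↔ Fin (partialCount v s k)
Partial↔Fin v       zero    zero    _ = singleton↔Fin1 ≡-irrelevant refl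
Partial↔Fin v       (suc s) zero    _ = empty↔Fin0 (λ ())
Partial↔Fin zero    zero    (suc j) _ = empty↔Fin0 λ (_ , R , _) → n≮0 (residual₀-width<v R)
Partial↔Fin (suc v) s       (suc j) s≤ = ↔-trans (step s≤)
  (↔-trans (Σ<↔Fin (suc v ∸ s) (λ t t< → Partial↔Fin v (s + t) (suc j) (<∸⇒+≤ s≤ t<))
      ⊎-↔ Σ<↔Fin s (λ c c<s → Partial↔Fin v c j (≤-pred (≤-trans c<s s≤))))
    (↔-sym +↔⊎))

DPPRows↔Partial : ∀ n k → DPPRows n k ↔ Partial n 0 k
DPPRows↔Partial n zero = ↔-trans (singleton↔Fin1 irrelevant ([] , tt , refl)) (↔-sym (singleton↔Fin1 ≡-irrelevant refl))
  where
  irrelevant : Irrelevant (DPPRows n 0)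
  irrelevant ([] , _ , _) ([] , _ , _) = DPPRows-≡ refl
DPPRows↔Partial n (suc j) = mk↔ₛ′ to from (λ _ → Partial-≡ refl) from∘to
  where
  to : DPPRows n (suc j) → Partial n 0 (suc j)
  to (r ∷ rows , ok , len) = (r , rows) , rows⇒residual ok , suc-injective len
  from : Partial n 0 (suc j) → DPPRows n (suc j)
  from ((r , rows) , R , len) = r ∷ rows , residual⇒rows R , cong suc len
  from∘to : ∀ x → from (to x) ≡ x
  from∘to (_ ∷ _ , _ , _) = DPPRows-≡ refl

-- The bijection holds for all n and k.
corollary2p9 : (n k : ℕ) → 1 ≤ n → k ≤ n ∸ 1 → DPPNoSpecial n k ↔ Fin (eulerian n k)
corollary2p9 n k _ _ = begin
  DPPNoSpecial n k          ↔⟨ DPPNoSpecial↔DPPRows n k ⟩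
  DPPRows n k               ↔⟨ DPPRows↔Partial n k ⟩
  Partial n 0 k             ↔⟨ Partial↔Fin n 0 k z≤n ⟩
  Fin (partialCount n 0 k)  ≡⟨ cong Fin (partialCount-eulerian n k) ⟩
  Fin (eulerian n k)        ∎
  where open EquationalReasoning
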